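{- $\Sigma_1^1$-automata are equivalent to first-order automata: for every $\Sigma_1^1$-automaton $\mathcal{A}$ with word signature $\Sigma$ there is a first-order automaton $\mathcal{A}_1$ with word signature $\Sigma$ such that $\mathcal{L}_{\mathcal{T}}(\mathcal{A}_1)=\mathcal{L}_{\mathcal{T}}(\mathcal{A})$ for every $\Sigma$-theory $\mathcal{T}$ (and every first-order automaton is in particular a $\Sigma_1^1$-automaton).
   Context: Signatures are multi-sorted first-order signatures in which every symbol is marked either rigid or non-rigid. For a signature $\Sigma$, $\Sigma'$ denotes the signature obtained from $\Sigma$ by replacing each non-rigid symbol $s$ by a fresh primed copy $s'$; for a $\Sigma$-structure $\sigma$, $\sigma'$ denotes the corresponding renamed $\Sigma'$-structure. For structures over pairwise disjoint signatures with the same sort domains, $\rho\cup\sigma\cup\tau'$ denotes the combined structure. A $\Sigma$-theory $\mathcal{T}$ is a set of $\Sigma$-sentences; $[\![\mathcal{T}]\!]$ is the set of all $\Sigma$-structures with finite or countably infinite domains satisfying $\mathcal{T}$. A $\mathcal{T}$-word is a finite sequence $\bar\sigma=\langle\sigma_0,\ldots,\sigma_{n-1}\rangle$ of elements of $[\![\mathcal{T}]\!]$ such that every sort domain and every rigid symbol of $\Sigma$ has the same interpretation in all $\sigma_i$. A first-order automaton is a tuple $\mathcal{A}=\langle\Sigma,\Gamma,\phi_0,\phi_T,\phi_F\rangle$ where $\Sigma$ (word signature) and $\Gamma$ (state signature) are finite disjoint signatures, $\phi_0,\phi_F$ are first-order $\Gamma$-sentences and $\phi_T$ is a first-order $(\Gamma\cup\Sigma\cup\Gamma')$-sentence.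 A $\Sigma_1^1$-automaton is a tuple of the same form except that $\phi_0$, $\phi_T$, $\phi_F$ are existential second-order sentences (of the form $\exists P_1\ldots\exists P_k\,\psi$ with $\psi$ first-order, over $\Gamma$, $\Gamma\cup\Sigma\cup\Gamma'$, and $\Gamma$ respectively, the $P_j$ being fresh relation symbols). For either kind of automaton, given a $\mathcal{T}$-word $\bar\sigma=\langle\sigma_0,\ldots,\sigma_{n-1}\rangle$, a $\mathcal{T}$-run induced by $\bar\sigma$ is a sequence $\langle\rho_0,\ldots,\rho_n\rangle$ of $\Gamma$-structures with $S^{\rho_i}=S^{\sigma_0}$ for every sort $S$ and all $i$, rigid symbols of $\Gamma$ interpreted identically in all $\rho_i$, $\rho_0\models\phi_0$ and $\rho_i\cup\sigma_i\cup\rho'_{i+1}\models\phi_T$ for all $0\le i<n$; the automaton $\mathcal{T}$-accepts $\bar\sigma$ iff some such run has $\rho_n\models\phi_F$, and $\mathcal{L}_{\mathcal{T}}(\mathcal{A})$ is the set of $\mathcal{T}$-words it $\mathcal{T}$-accepts. -}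

module Defs where

open import Level using (Level; _⊔_) renaming (suc to lsuc; zero to lzero)
open import Data.Nat using (ℕ; zero; suc)
open import Data.Fin using (Fin; zero; suc; inject₁; fromℕ)
open import Data.Bool using (Bool; true; false)
open import Data.List using (List; []; _∷_)
open import Data.List.Membership.Propositional using (_∈_)
open import Data.List.Relation.Unary.All as All using (All; []; _∷_)
open import Data.Empty using (⊥)
open import Data.Unit using (⊤)
open import Data.Sum using (_⊎_; inj₁; inj₂; [_,_])
open import Data.Product using (Σ; _×_; _,_; proj₁)
open import Function.Definitions using (Injective)
open import Function.Bundles using (_⇔_)
open import Relation.Binary.PropositionalEquality using (_≡_)

record Sig (k : ℕ) : Set₁ where
  field
    Fun    : Set
    Rel    : Set
    fdom   : Fun → List (Fin k)
    fcod   : Fun → Fin k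
    rdom   : Rel → List (Fin k)
    frigid : Fun → Bool
    rrigid : Rel → Bool
open Sig public

record FinSig (k : ℕ) : Set where
  field
    nF     : ℕ
    nR     : ℕ
    ffdom  : Fin nF → List (Fin k)
    ffcod  : Fin nF → Fin k
    frdom  : Fin nR → List (Fin k)
    ffrig  : Fin nF → Bool
    frrig  : Fin nR → Bool
open FinSig public

⌊_⌋ : ∀ {k} → FinSig k → Sig k
⌊ S ⌋ = record { Fun = Fin (nF S) ; Rel = Fin (nR S) ; fdom = ffdom S ; fcod = ffcod S
               ; rdom = frdom S ; frigid = ffrig S ; rrigid = frrig S }

_⊕_ : ∀ {k} → Sig k → Sig k → Sig k
S ⊕ S' = record
  { Fun = Fun S ⊎ Fun S' ; Rel = Rel S ⊎ Rel S'
  ; fdom = [ fdom S , fdom S' ] ; fcod = [ fcod S , fcod S' ]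
  ; rdom = [ rdom S , rdom S' ]
  ; frigid = [ frigid S , frigid S' ] ; rrigid = [ rrigid S , rrigid S' ] }
infixl 6 _⊕_

-- the primed copies of the non-rigid symbols (the new part of S')
NR : ∀ {k} → Sig k → Sig k
NR S = record
  { Fun = Σ (Fun S) (λ f → frigid S f ≡ false) ; Rel = Σ (Rel S) (λ r → rrigid S r ≡ false)
  ; fdom = λ f → fdom S (proj₁ f) ; fcod = λ f → fcod S (proj₁ f)
  ; rdom = λ r → rdom S (proj₁ r) ; frigid = λ _ → false ; rrigid = λ _ → false }

RelSig : ∀ {k} (m : ℕ) → (Fin m → List (Fin k)) → Sig k
RelSig m ar = record
  { Fun = ⊥ ; Rel = Fin m ; fdom = λ () ; fcod = λ () ; rdom = ar
  ; frigid = λ () ; rrigid = λ _ → false }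

module _ {k : ℕ} (S : Sig k) where
  mutual
    data Term (Γ : List (Fin k)) : Fin k → Set where
      var : ∀ {s} → s ∈ Γ → Term Γ s
      app : (f : Fun S) → Terms Γ (fdom S f) → Term Γ (fcod S f)

    data Terms (Γ : List (Fin k)) : List (Fin k) → Set where
      []  : Terms Γ []
      _∷_ : ∀ {s ss} → Term Γ s → Terms Γ ss → Terms Γ (s ∷ ss)

  data Formula (Γ : List (Fin k)) : Set where
    tt ff  : Formula Γ
    eq     : ∀ {s} → Term Γ s → Term Γ s → Formula Γ
    rel    : (r : Rel S) → Terms Γ (rdom S r) → Formula Γ
    not    : Formula Γ → Formula Γ
    and or imp : Formula Γ → Formula Γ → Formula Γ
    all ex : (s : Fin k) → Formula (s ∷ Γ) → Formula Γ

  Sentence : Set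
  Sentence = Formula []

record Structure {k} (D : Fin k → Set) (S : Sig k) : Set₁ where
  field
    fun : (f : Fun S) → All D (fdom S f) → D (fcod S f)
    rl  : (r : Rel S) → All D (rdom S r) → Set
open Structure public

module _ {k} {D : Fin k → Set} {S : Sig k} (M : Structure D S) where
  mutual
    eval : ∀ {Γ s} → All D Γ → Term S Γ s → D s
    eval e (var x)    = All.lookup e x
    eval e (app f ts) = fun M f (evals e ts)

    evals : ∀ {Γ ss} → All D Γ → Terms S Γ ss → All D ss
    evals e []       = []
    evals e (t ∷ ts) = eval e t ∷ evals e ts

  Sat : ∀ {Γ} → All D Γ → Formula S Γ → Set
  Sat e tt          = ⊤
  Sat e ff          = ⊥
  Sat e (eq t u)    = eval e t ≡ eval e u
  Sat e (rel r ts)  = rl M r (evals e ts)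
  Sat e (not φ)     = Sat e φ → ⊥
  Sat e (and φ ψ)   = Sat e φ × Sat e ψ
  Sat e (or φ ψ)    = Sat e φ ⊎ Sat e ψ
  Sat e (imp φ ψ)   = Sat e φ → Sat e ψ
  Sat e (all s φ)   = (d : D s) → Sat (d ∷ e) φ
  Sat e (ex s φ)    = Σ (D s) λ d → Sat (d ∷ e) φ

_⊨_ : ∀ {k} {D : Fin k → Set} {S : Sig k} → Structure D S → Sentence S → Set
M ⊨ φ = Sat M [] φ

_∪ₛ_ : ∀ {k} {D : Fin k → Set} {S S' : Sig k} → Structure D S → Structure D S' → Structure D (S ⊕ S')
M ∪ₛ N = record { fun = λ { (inj₁ f) → fun M f ; (inj₂ f) → fun N f }
                ; rl  = λ { (inj₁ r) → rl M r ; (inj₂ r) → rl N r } }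
infixl 6 _∪ₛ_

prime : ∀ {k} {D : Fin k → Set} {S : Sig k} → Structure D S → Structure D (NR S)
prime M = record { fun = λ f → fun M (proj₁ f) ; rl = λ r → rl M (proj₁ r) }

AgreeRigid : ∀ {k} {D : Fin k → Set} {S : Sig k} → Structure D S → Structure D S → Set
AgreeRigid {S = S} M N =
  ((f : Fun S) → frigid S f ≡ true → ∀ as → fun M f as ≡ fun N f as) ×
  ((r : Rel S) → rrigid S r ≡ true → ∀ as → rl M r as ⇔ rl N r as)

-- Existential second-order sentences  ∃P₁…∃Pₘ ψ

record SOSentence {k} (S : Sig k) : Set where
  field
    m    : ℕ
    ar   : Fin m → List (Fin k)
    body : Sentence (S ⊕ RelSig m ar)
open SOSentence public

_⊨SO_ : ∀ {k} {D : Fin k → Set} {S : Sig k} → Structure D S → SOSentence S → Set₁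
_⊨SO_ {D = D} M ψ =
  Σ ((j : Fin (m ψ)) → All D (ar ψ j) → Set) λ P →
    (M ∪ₛ record { fun = λ () ; rl = P }) ⊨ body ψ

Theory : ∀ {k} → Sig k → Set₁
Theory S = Sentence S → Set

Models : ∀ {k} {D : Fin k → Set} {S : Sig k} → Theory S → Structure D S → Set
Models T M = ∀ φ → T φ → M ⊨ φ

-- nonempty, finite or countably infinite sort domains
record Domains (k : ℕ) : Set₁ where
  field
    D       : Fin k → Set
    enc     : ∀ s → D s → ℕ
    enc-inj : ∀ s → Injective _≡_ _≡_ (enc s)
    point   : ∀ s → D s
open Domains public

record Word {k} (Σs : Sig k) (T : Theory Σs) : Set₁ where
  field
    len    : ℕ
    dom    : Domains k
    letter : Fin len → Structure (D dom) Σs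
    models : ∀ i → Models T (letter i)
    rigid  : ∀ i j → AgreeRigid (letter i) (letter j)
open Word public

record Run {ℓ : Level} {k} {Σs : Sig k} {T : Theory Σs} (w : Word Σs T) (Γ : Sig k)
           (init : Structure (D (dom w)) Γ → Set ℓ)
           (trans : Structure (D (dom w)) (Γ ⊕ Σs ⊕ NR Γ) → Set ℓ) : Set (lsuc lzero ⊔ ℓ) where
  field
    state : Fin (suc (len w)) → Structure (D (dom w)) Γ
    srig  : ∀ i j → AgreeRigid (state i) (state j)
    start : init (state zero)
    step  : ∀ i → trans (state (inject₁ i) ∪ₛ letter w i ∪ₛ prime (state (suc i)))
open Run public

record FOAutomaton {k} (Σs : FinSig k) : Set where
  field
    Γ  : FinSig k
    φ₀ : Sentence ⌊ Γ ⌋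
    φT : Sentence (⌊ Γ ⌋ ⊕ ⌊ Σs ⌋ ⊕ NR ⌊ Γ ⌋)
    φF : Sentence ⌊ Γ ⌋

record SOAutomaton {k} (Σs : FinSig k) : Set where
  field
    Γ  : FinSig k
    φ₀ : SOSentence ⌊ Γ ⌋
    φT : SOSentence (⌊ Γ ⌋ ⊕ ⌊ Σs ⌋ ⊕ NR ⌊ Γ ⌋)
    φF : SOSentence ⌊ Γ ⌋

FOAccepts : ∀ {k} {Σs : FinSig k} {T : Theory ⌊ Σs ⌋} → FOAutomaton Σs → Word ⌊ Σs ⌋ T → Set₁
FOAccepts A w = Σ (Run w ⌊ FOAutomaton.Γ A ⌋ (_⊨ FOAutomaton.φ₀ A) (_⊨ FOAutomaton.φT A)) λ r →
  state r (fromℕ (len w)) ⊨ FOAutomaton.φF A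

SOAccepts : ∀ {k} {Σs : FinSig k} {T : Theory ⌊ Σs ⌋} → SOAutomaton Σs → Word ⌊ Σs ⌋ T → Set₁
SOAccepts A w = Σ (Run w ⌊ SOAutomaton.Γ A ⌋ (_⊨SO SOAutomaton.φ₀ A) (_⊨SO SOAutomaton.φT A)) λ r →
  state r (fromℕ (len w)) ⊨SO SOAutomaton.φF A

SameLanguages : ∀ {k} {Σs : FinSig k} → FOAutomaton Σs → SOAutomaton Σs → Set₁
SameLanguages {Σs = Σs} A₁ A = (T : Theory ⌊ Σs ⌋) (w : Word ⌊ Σs ⌋ T) → FOAccepts A₁ w ⇔ SOAccepts A w

{-# OPTIONS --safe #-}
-- Non-rigid state symbols may be interpreted independently in every state, so the relations
-- quantified in a Σ¹₁-automaton can be guessed as part of the run: the first-order automaton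
-- extends Γ by three blocks of fresh non-rigid relation symbols and reads the relations quantified
-- in φ₀ off the first state, those in φF off the last state, and those in the transition from
-- state i to state i+1 off the primed copy of state i+1. A first-order sentence is a Σ¹₁-sentence
-- quantifying no relations.
module Submission where

open import Defs
open import Data.Nat using (ℕ; suc; _+_)
open import Data.Fin using (Fin; zero; suc; splitAt; _↑ˡ_; _↑ʳ_)
open import Data.Fin.Properties using (splitAt-↑ˡ; splitAt-↑ʳ)
open import Data.Bool using (Bool; true; false)
open import Data.List using (List)
open import Data.List.Relation.Unary.All using (All; []; _∷_)
open import Data.Unit using (⊤)
open import Data.Sum using (_⊎_; inj₁; inj₂; [_,_]; [_,_]′)
open import Data.Sum.Function.Propositional using (_⊎-⇔_)
open import Data.Product using (Σ; _×_; _,_; proj₁)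
open import Data.Product.Function.NonDependent.Propositional using (_×-⇔_)
open import Function using (id; _∘_)
open import Function.Bundles using (_⇔_; mk⇔; Equivalence)
open import Function.Construct.Identity using (⇔-id)
open import Function.Construct.Composition using (_⇔-∘_)
open import Function.Related.TypeIsomorphisms using (→-cong-⇔; ¬-cong-⇔)
open import Relation.Binary.PropositionalEquality
  using (_≡_; refl; sym; trans; cong; subst; module ≡-Reasoning)
open import Relation.Binary.PropositionalEquality.Properties
  using (subst-application′; subst-subst)

open Equivalence using (to; from)

private
  variable
    k : ℕ
    Dom : Fin k → Set
    S S' T U : Sig k

-- Arities are preserved only propositionally: those of G ⊞ ar below compute through splitAt.
record Renaming (S S' : Sig k) : Set where
  field
    mapFun       : Fun S → Fun S'
    mapFun-dom   : ∀ f → fdom S f ≡ fdom S' (mapFun f)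
    mapFun-cod   : ∀ f → fcod S' (mapFun f) ≡ fcod S f
    mapFun-rigid : ∀ f → frigid S' (mapFun f) ≡ frigid S f
    mapRel       : Rel S → Rel S'
    mapRel-dom   : ∀ r → rdom S r ≡ rdom S' (mapRel r)
    mapRel-rigid : ∀ r → rrigid S' (mapRel r) ≡ rrigid S r
open Renaming public

module _ (h : Renaming S S') where
  mutual
    renameTerm : ∀ {Γ s} → Term S Γ s → Term S' Γ s
    renameTerm (var x)    = var x
    renameTerm (app f ts) = subst (Term S' _) (mapFun-cod h f) (app (mapFun h f) (renameArgs (mapFun-dom h f) ts))

    renameArgs : ∀ {Γ ss ss'} → ss ≡ ss' → Terms S Γ ss → Terms S' Γ ss'
    renameArgs p ts = subst (Terms S' _) p (renameTerms ts)

    renameTerms : ∀ {Γ ss} → Terms S Γ ss → Terms S' Γ ss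
    renameTerms []       = []
    renameTerms (t ∷ ts) = renameTerm t ∷ renameTerms ts

  rename : ∀ {Γ} → Formula S Γ → Formula S' Γ
  rename tt         = tt
  rename ff         = ff
  rename (eq t u)   = eq (renameTerm t) (renameTerm u)
  rename (rel r ts) = rel (mapRel h r) (renameArgs (mapRel-dom h r) ts)
  rename (not φ)    = not (rename φ)
  rename (and φ ψ)  = and (rename φ) (rename ψ)
  rename (or φ ψ)   = or (rename φ) (rename ψ)
  rename (imp φ ψ)  = imp (rename φ) (rename ψ)
  rename (all s φ)  = all s (rename φ)
  rename (ex s φ)   = ex s (rename φ)

infixl 7 _∣_
_∣_ : Structure Dom S' → Renaming S S' → Structure Dom S
_∣_ {Dom = Dom} N h = record
  { fun = λ f as → subst Dom (mapFun-cod h f) (fun N (mapFun h f) (subst (All Dom) (mapFun-dom h f) as))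
  ; rl  = λ r as → rl N (mapRel h r) (subst (All Dom) (mapRel-dom h r) as) }

record IsReduct (h : Renaming S S') (M : Structure Dom S) (N : Structure Dom S') : Set where
  constructor mkReduct
  field
    fun-reduct : ∀ f as → fun (N ∣ h) f as ≡ fun M f as
    rl-reduct  : ∀ r as → rl (N ∣ h) r as ⇔ rl M r as
open IsReduct public

module _ {h : Renaming S S'} {M : Structure Dom S} {N : Structure Dom S'} (M◁N : IsReduct h M N) where
  open ≡-Reasoning

  mutual
    eval-rename : ∀ {Γ s} (e : All Dom Γ) (t : Term S Γ s) → eval N e (renameTerm h t) ≡ eval M e t
    eval-rename e (var x)    = refl
    eval-rename e (app f ts) = begin
      eval N e (subst (Term S' _) (mapFun-cod h f) (app (mapFun h f) (renameArgs h (mapFun-dom h f) ts)))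
        ≡⟨ subst-application′ (Term S' _) (λ _ → eval N e) (mapFun-cod h f) ⟨
      subst Dom (mapFun-cod h f) (fun N (mapFun h f) (evals N e (renameArgs h (mapFun-dom h f) ts)))
        ≡⟨ cong (λ as → subst Dom (mapFun-cod h f) (fun N (mapFun h f) as))
                (evals-renameArgs e (mapFun-dom h f) ts) ⟩
      fun (N ∣ h) f (evals M e ts)
        ≡⟨ fun-reduct M◁N f (evals M e ts) ⟩
      fun M f (evals M e ts) ∎

    evals-renameArgs : ∀ {Γ ss ss'} (e : All Dom Γ) (p : ss ≡ ss') (ts : Terms S Γ ss) →
      evals N e (renameArgs h p ts) ≡ subst (All Dom) p (evals M e ts)
    evals-renameArgs e p ts = begin
      evals N e (subst (Terms S' _) p (renameTerms h ts)) ≡⟨ subst-application′ (Terms S' _) (λ _ → evals N e) p ⟨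
      subst (All Dom) p (evals N e (renameTerms h ts))      ≡⟨ cong (subst (All Dom) p) (evals-rename e ts) ⟩
      subst (All Dom) p (evals M e ts)                      ∎

    evals-rename : ∀ {Γ ss} (e : All Dom Γ) (ts : Terms S Γ ss) → evals N e (renameTerms h ts) ≡ evals M e ts
    evals-rename e []       = refl
    evals-rename e (t ∷ ts) rewrite eval-rename e t | evals-rename e ts = refl

  sat-rename : ∀ {Γ} (e : All Dom Γ) (φ : Formula S Γ) → Sat N e (rename h φ) ⇔ Sat M e φ
  sat-rename e tt         = ⇔-id _
  sat-rename e ff         = ⇔-id _
  sat-rename e (eq t u) rewrite eval-rename e t | eval-rename e u = ⇔-id _
  sat-rename e (rel r ts) rewrite evals-renameArgs e (mapRel-dom h r) ts = rl-reduct M◁N r (evals M e ts)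
  sat-rename e (not φ)    = ¬-cong-⇔ (sat-rename e φ)
  sat-rename e (and φ ψ)  = sat-rename e φ ×-⇔ sat-rename e ψ
  sat-rename e (or φ ψ)   = sat-rename e φ ⊎-⇔ sat-rename e ψ
  sat-rename e (imp φ ψ)  = →-cong-⇔ (sat-rename e φ) (sat-rename e ψ)
  sat-rename e (all s φ)  = mk⇔ (λ p d → to (sat-rename (d ∷ e) φ) (p d))
                                (λ p d → from (sat-rename (d ∷ e) φ) (p d))
  sat-rename e (ex s φ)   = mk⇔ (λ (d , p) → d , to (sat-rename (d ∷ e) φ) p)
                                (λ (d , p) → d , from (sat-rename (d ∷ e) φ) p)

  ⊨-rename : (φ : Sentence S) → N ⊨ rename h φ ⇔ M ⊨ φ
  ⊨-rename = sat-rename []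

idᴿ : Renaming S S
idᴿ = record
  { mapFun = id ; mapFun-dom = λ _ → refl ; mapFun-cod = λ _ → refl ; mapFun-rigid = λ _ → refl
  ; mapRel = id ; mapRel-dom = λ _ → refl ; mapRel-rigid = λ _ → refl }

infixr 9 _∘ᴿ_
_∘ᴿ_ : Renaming T U → Renaming S T → Renaming S U
g ∘ᴿ h = record
  { mapFun       = λ f → mapFun g (mapFun h f)
  ; mapFun-dom   = λ f → trans (mapFun-dom h f) (mapFun-dom g (mapFun h f))
  ; mapFun-cod   = λ f → trans (mapFun-cod g (mapFun h f)) (mapFun-cod h f)
  ; mapFun-rigid = λ f → trans (mapFun-rigid g (mapFun h f)) (mapFun-rigid h f)
  ; mapRel       = λ r → mapRel g (mapRel h r)
  ; mapRel-dom   = λ r → trans (mapRel-dom h r) (mapRel-dom g (mapRel h r))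
  ; mapRel-rigid = λ r → trans (mapRel-rigid g (mapRel h r)) (mapRel-rigid h r) }

inj₁ᴿ : Renaming S (S ⊕ S')
inj₁ᴿ = record
  { mapFun = inj₁ ; mapFun-dom = λ _ → refl ; mapFun-cod = λ _ → refl ; mapFun-rigid = λ _ → refl
  ; mapRel = inj₁ ; mapRel-dom = λ _ → refl ; mapRel-rigid = λ _ → refl }

inj₂ᴿ : Renaming S' (S ⊕ S')
inj₂ᴿ = record
  { mapFun = inj₂ ; mapFun-dom = λ _ → refl ; mapFun-cod = λ _ → refl ; mapFun-rigid = λ _ → refl
  ; mapRel = inj₂ ; mapRel-dom = λ _ → refl ; mapRel-rigid = λ _ → refl }

[_,_]ᴿ : Renaming S U → Renaming T U → Renaming (S ⊕ T) U
[ h , g ]ᴿ = record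
  { mapFun       = [ mapFun h , mapFun g ]′
  ; mapFun-dom   = [ mapFun-dom h , mapFun-dom g ]
  ; mapFun-cod   = [ mapFun-cod h , mapFun-cod g ]
  ; mapFun-rigid = [ mapFun-rigid h , mapFun-rigid g ]
  ; mapRel       = [ mapRel h , mapRel g ]′
  ; mapRel-dom   = [ mapRel-dom h , mapRel-dom g ]
  ; mapRel-rigid = [ mapRel-rigid h , mapRel-rigid g ] }

infixl 6 _⊕ᴿ_
_⊕ᴿ_ : Renaming S S' → Renaming T U → Renaming (S ⊕ T) (S' ⊕ U)
h ⊕ᴿ g = [ inj₁ᴿ ∘ᴿ h , inj₂ᴿ ∘ᴿ g ]ᴿ

primeᴿ : Renaming S S' → Renaming (NR S) (NR S')
primeᴿ h = record
  { mapFun       = λ (f , p) → mapFun h f , trans (mapFun-rigid h f) p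
  ; mapFun-dom   = λ (f , _) → mapFun-dom h f
  ; mapFun-cod   = λ (f , _) → mapFun-cod h f
  ; mapFun-rigid = λ _ → refl
  ; mapRel       = λ (r , p) → mapRel h r , trans (mapRel-rigid h r) p
  ; mapRel-dom   = λ (r , _) → mapRel-dom h r
  ; mapRel-rigid = λ _ → refl }

toPrimedᴿ : (h : Renaming S S') → (∀ f → frigid S f ≡ false) → (∀ r → rrigid S r ≡ false) →
  Renaming S (NR S')
toPrimedᴿ h fun-flexible rel-flexible = record
  { mapFun       = λ f → mapFun h f , trans (mapFun-rigid h f) (fun-flexible f)
  ; mapFun-dom   = mapFun-dom h
  ; mapFun-cod   = mapFun-cod h
  ; mapFun-rigid = λ f → sym (fun-flexible f)
  ; mapRel       = λ r → mapRel h r , trans (mapRel-rigid h r) (rel-flexible r)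
  ; mapRel-dom   = mapRel-dom h
  ; mapRel-rigid = λ r → sym (rel-flexible r) }

∣-isReduct : (h : Renaming S S') {N : Structure Dom S'} → IsReduct h (N ∣ h) N
∣-isReduct h = mkReduct (λ _ _ → refl) (λ _ _ → ⇔-id _)

isReduct-id : {M : Structure Dom S} → IsReduct idᴿ M M
isReduct-id = ∣-isReduct idᴿ

isReduct-inj₁ : {M : Structure Dom S} {N : Structure Dom S'} → IsReduct inj₁ᴿ M (M ∪ₛ N)
isReduct-inj₁ = ∣-isReduct inj₁ᴿ

isReduct-inj₂ : {M : Structure Dom S} {N : Structure Dom S'} → IsReduct inj₂ᴿ N (M ∪ₛ N)
isReduct-inj₂ = ∣-isReduct inj₂ᴿ

isReduct-∘ : {g : Renaming T U} {h : Renaming S T} {M : Structure Dom S} {M' : Structure Dom T}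
  {N : Structure Dom U} → IsReduct h M M' → IsReduct g M' N → IsReduct (g ∘ᴿ h) M N
isReduct-∘ {Dom = Dom} {g = g} {h} {M} {M'} {N} M◁M' M'◁N = mkReduct fun-comp rl-comp
  where
    open ≡-Reasoning
    fun-comp : ∀ f as → fun (N ∣ g ∘ᴿ h) f as ≡ fun M f as
    fun-comp f as = begin
      subst Dom (trans cod-g cod-h) (fun N (mapFun g f') (subst (All Dom) (trans dom-h dom-g) as))
        ≡⟨ subst-subst cod-g ⟨
      subst Dom cod-h (subst Dom cod-g (fun N (mapFun g f') (subst (All Dom) (trans dom-h dom-g) as)))
        ≡⟨ cong (λ bs → subst Dom cod-h (subst Dom cod-g (fun N (mapFun g f') bs))) (subst-subst dom-h) ⟨
      subst Dom cod-h (fun (N ∣ g) f' (subst (All Dom) dom-h as))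
        ≡⟨ cong (subst Dom cod-h) (fun-reduct M'◁N f' _) ⟩
      fun (M' ∣ h) f as
        ≡⟨ fun-reduct M◁M' f as ⟩
      fun M f as ∎
      where
        f' = mapFun h f
        dom-h = mapFun-dom h f
        dom-g = mapFun-dom g f'
        cod-h = mapFun-cod h f
        cod-g = mapFun-cod g f'

    rl-comp : ∀ r as → rl (N ∣ g ∘ᴿ h) r as ⇔ rl M r as
    rl-comp r as rewrite sym (subst-subst {P = All Dom} (mapRel-dom h r) {mapRel-dom g (mapRel h r)} {as}) =
      rl-reduct M◁M' r as ⇔-∘ rl-reduct M'◁N (mapRel h r) _

isReduct-[,] : {h : Renaming S U} {g : Renaming T U} {M : Structure Dom S} {M' : Structure Dom T}
  {N : Structure Dom U} → IsReduct h M N → IsReduct g M' N → IsReduct [ h , g ]ᴿ (M ∪ₛ M') N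
isReduct-[,] (mkReduct fun₁ rl₁) (mkReduct fun₂ rl₂) = mkReduct [ fun₁ , fun₂ ] [ rl₁ , rl₂ ]

isReduct-⊕ : {h : Renaming S S'} {g : Renaming T U} {M : Structure Dom S} {N : Structure Dom S'}
  {M' : Structure Dom T} {N' : Structure Dom U} →
  IsReduct h M N → IsReduct g M' N' → IsReduct (h ⊕ᴿ g) (M ∪ₛ M') (N ∪ₛ N')
isReduct-⊕ M◁N M'◁N' = isReduct-[,] (isReduct-∘ M◁N isReduct-inj₁) (isReduct-∘ M'◁N' isReduct-inj₂)

isReduct-prime : {h : Renaming S S'} {M : Structure Dom S} {N : Structure Dom S'} →
  IsReduct h M N → IsReduct (primeᴿ h) (prime M) (prime N)
isReduct-prime (mkReduct fun-red rl-red) = mkReduct (λ (f , _) → fun-red f) (λ (r , _) → rl-red r)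

isReduct-toPrimed : {h : Renaming S S'} {fun-flexible : ∀ f → frigid S f ≡ false}
  {rel-flexible : ∀ r → rrigid S r ≡ false} {M : Structure Dom S} {N : Structure Dom S'} →
  IsReduct h M N → IsReduct (toPrimedᴿ h fun-flexible rel-flexible) M (prime N)
isReduct-toPrimed (mkReduct fun-red rl-red) = mkReduct fun-red rl-red

agreeRigid-∣ : (h : Renaming S S') {N N' : Structure Dom S'} → AgreeRigid N N' → AgreeRigid (N ∣ h) (N' ∣ h)
agreeRigid-∣ {Dom = Dom} h (fun-agree , rl-agree) =
  (λ f p as → cong (subst Dom (mapFun-cod h f)) (fun-agree (mapFun h f) (trans (mapFun-rigid h f) p) _)) ,
  (λ r p as → rl-agree (mapRel h r) (trans (mapRel-rigid h r) p) _)

Relations : (Dom : Fin k → Set) {m : ℕ} → (Fin m → List (Fin k)) → Set₁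
Relations Dom {m} ar = (j : Fin m) → All Dom (ar j) → Set

relStructure : {m : ℕ} {ar : Fin m → List (Fin k)} → Relations Dom ar → Structure Dom (RelSig m ar)
relStructure P = record { fun = λ () ; rl = P }

flatten : Renaming S S' → (ψ : SOSentence S) → Renaming (RelSig (m ψ) (ar ψ)) S' → Sentence S'
flatten h ψ g = rename [ h , g ]ᴿ (body ψ)

module _ {h : Renaming S S'} {M : Structure Dom S} {N : Structure Dom S'} (M◁N : IsReduct h M N)
         (ψ : SOSentence S) (g : Renaming (RelSig (m ψ) (ar ψ)) S') where

  flatten-sound : N ⊨ flatten h ψ g → M ⊨SO ψ
  flatten-sound N⊨ = rl (N ∣ g) , to (⊨-rename (isReduct-[,] M◁N witness◁N) (body ψ)) N⊨
    where
      witness◁N : IsReduct g (relStructure (rl (N ∣ g))) N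
      witness◁N = mkReduct (λ ()) (λ _ _ → ⇔-id _)

  flatten-complete : ((P , _) : M ⊨SO ψ) → IsReduct g (relStructure P) N → N ⊨ flatten h ψ g
  flatten-complete (P , M∪P⊨) P◁N = from (⊨-rename (isReduct-[,] M◁N P◁N) (body ψ)) M∪P⊨

module _ (G : FinSig k) {m : ℕ} (ar : Fin m → List (Fin k)) where

  private
    arity : Fin (nR G) ⊎ Fin m → List (Fin k)
    arity = [ frdom G , ar ]′

    rigidity : Fin (nR G) ⊎ Fin m → Bool
    rigidity = [ frrig G , (λ _ → false) ]′

  infixl 6 _⊞_
  _⊞_ : FinSig k
  _⊞_ = record G { nR = nR G + m ; frdom = arity ∘ splitAt (nR G) ; frrig = rigidity ∘ splitAt (nR G) }

  oldᴿ : Renaming ⌊ G ⌋ ⌊ _⊞_ ⌋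
  oldᴿ = record
    { mapFun = id ; mapFun-dom = λ _ → refl ; mapFun-cod = λ _ → refl ; mapFun-rigid = λ _ → refl
    ; mapRel       = _↑ˡ m
    ; mapRel-dom   = λ r → cong arity (sym (splitAt-↑ˡ (nR G) r m))
    ; mapRel-rigid = λ r → cong rigidity (splitAt-↑ˡ (nR G) r m) }

  freshᴿ : Renaming (RelSig m ar) ⌊ _⊞_ ⌋
  freshᴿ = record
    { mapFun = λ () ; mapFun-dom = λ () ; mapFun-cod = λ () ; mapFun-rigid = λ ()
    ; mapRel       = nR G ↑ʳ_
    ; mapRel-dom   = λ j → cong arity (sym (splitAt-↑ʳ (nR G) m j))
    ; mapRel-rigid = λ j → cong rigidity (splitAt-↑ʳ (nR G) m j) }

  module _ {Dom : Fin k → Set} where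
    private
      rl⊞ : Structure Dom ⌊ G ⌋ → Relations Dom ar → (x : Fin (nR G) ⊎ Fin m) → All Dom (arity x) → Set
      rl⊞ M P (inj₁ r) = rl M r
      rl⊞ M P (inj₂ j) = P j

      rl⊞-cast : ∀ {M P x y} (x≡y : x ≡ y) as → rl⊞ M P y (subst (All Dom) (cong arity x≡y) as) ⇔ rl⊞ M P x as
      rl⊞-cast refl as = ⇔-id _

    expand : Structure Dom ⌊ G ⌋ → Relations Dom ar → Structure Dom ⌊ _⊞_ ⌋
    expand M P = record { fun = fun M ; rl = rl⊞ M P ∘ splitAt (nR G) }

    isReduct-old : {M : Structure Dom ⌊ G ⌋} {P : Relations Dom ar} → IsReduct oldᴿ M (expand M P)
    isReduct-old = mkReduct (λ _ _ → refl) (λ r → rl⊞-cast (sym (splitAt-↑ˡ (nR G) r m)))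

    isReduct-fresh : {M : Structure Dom ⌊ G ⌋} {P : Relations Dom ar} →
      IsReduct freshᴿ (relStructure P) (expand M P)
    isReduct-fresh = mkReduct (λ ()) (λ j → rl⊞-cast (sym (splitAt-↑ʳ (nR G) m j)))

    agreeRigid-expand : {M M' : Structure Dom ⌊ G ⌋} {P P' : Relations Dom ar} →
      AgreeRigid M M' → AgreeRigid (expand M P) (expand M' P')
    agreeRigid-expand {M} {M'} {P} {P'} (fun-agree , rl-agree) = fun-agree , λ r → rl-agreeOf (splitAt (nR G) r)
      where
        rl-agreeOf : ∀ x → rigidity x ≡ true → ∀ as → rl⊞ M P x as ⇔ rl⊞ M' P' x as
        rl-agreeOf (inj₁ r) = rl-agree r
        rl-agreeOf (inj₂ j) ()

module Flattening {Σs : FinSig k} (A : SOAutomaton Σs) where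
  open SOAutomaton A

  Γ₁ : FinSig k
  Γ₁ = Γ ⊞ ar φ₀ ⊞ ar φT ⊞ ar φF

  embᴿ : Renaming ⌊ Γ ⌋ ⌊ Γ₁ ⌋
  embᴿ = oldᴿ _ _ ∘ᴿ oldᴿ _ _ ∘ᴿ oldᴿ _ _

  stepᴿ : Renaming (⌊ Γ ⌋ ⊕ ⌊ Σs ⌋ ⊕ NR ⌊ Γ ⌋) (⌊ Γ₁ ⌋ ⊕ ⌊ Σs ⌋ ⊕ NR ⌊ Γ₁ ⌋)
  stepᴿ = embᴿ ⊕ᴿ idᴿ ⊕ᴿ primeᴿ embᴿ

  fresh₀ᴿ : Renaming (RelSig (m φ₀) (ar φ₀)) ⌊ Γ₁ ⌋
  fresh₀ᴿ = oldᴿ _ _ ∘ᴿ oldᴿ _ _ ∘ᴿ freshᴿ Γ (ar φ₀)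

  freshTᴿ : Renaming (RelSig (m φT) (ar φT)) (⌊ Γ₁ ⌋ ⊕ ⌊ Σs ⌋ ⊕ NR ⌊ Γ₁ ⌋)
  freshTᴿ = inj₂ᴿ ∘ᴿ toPrimedᴿ (oldᴿ _ _ ∘ᴿ freshᴿ (Γ ⊞ ar φ₀) (ar φT)) (λ ()) (λ _ → refl)

  freshFᴿ : Renaming (RelSig (m φF) (ar φF)) ⌊ Γ₁ ⌋
  freshFᴿ = freshᴿ (Γ ⊞ ar φ₀ ⊞ ar φT) (ar φF)

  A₁ : FOAutomaton Σs
  A₁ = record
    { Γ  = Γ₁
    ; φ₀ = flatten embᴿ φ₀ fresh₀ᴿ
    ; φT = flatten stepᴿ φT freshTᴿ
    ; φF = flatten embᴿ φF freshFᴿ }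

  isReduct-step : {M M' : Structure Dom ⌊ Γ ⌋} {N N' : Structure Dom ⌊ Γ₁ ⌋} {σ : Structure Dom ⌊ Σs ⌋} →
    IsReduct embᴿ M N → IsReduct embᴿ M' N' → IsReduct stepᴿ (M ∪ₛ σ ∪ₛ prime M') (N ∪ₛ σ ∪ₛ prime N')
  isReduct-step M◁N M'◁N' = isReduct-⊕ (isReduct-⊕ M◁N isReduct-id) (isReduct-prime M'◁N')

  expandΓ₁ : Structure Dom ⌊ Γ ⌋ → Relations Dom (ar φ₀) → Relations Dom (ar φT) → Relations Dom (ar φF) →
    Structure Dom ⌊ Γ₁ ⌋
  expandΓ₁ M P₀ PT PF = expand _ _ (expand _ _ (expand _ _ M P₀) PT) PF

  module _ {M : Structure Dom ⌊ Γ ⌋} {P₀ : Relations Dom (ar φ₀)} {PT : Relations Dom (ar φT)}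
           {PF : Relations Dom (ar φF)} where
    isReduct-emb : IsReduct embᴿ M (expandΓ₁ M P₀ PT PF)
    isReduct-emb = isReduct-∘ (isReduct-∘ (isReduct-old _ _) (isReduct-old _ _)) (isReduct-old _ _)

    isReduct-fresh₀ : IsReduct fresh₀ᴿ (relStructure P₀) (expandΓ₁ M P₀ PT PF)
    isReduct-fresh₀ = isReduct-∘ (isReduct-∘ (isReduct-fresh _ _) (isReduct-old _ _)) (isReduct-old _ _)

    isReduct-freshT : {N : Structure Dom ⌊ Γ₁ ⌋} {σ : Structure Dom ⌊ Σs ⌋} →
      IsReduct freshTᴿ (relStructure PT) (N ∪ₛ σ ∪ₛ prime (expandΓ₁ M P₀ PT PF))
    isReduct-freshT =
      isReduct-∘ (isReduct-toPrimed (isReduct-∘ (isReduct-fresh _ _) (isReduct-old _ _))) isReduct-inj₂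

    isReduct-freshF : IsReduct freshFᴿ (relStructure PF) (expandΓ₁ M P₀ PT PF)
    isReduct-freshF = isReduct-fresh _ _

  module _ {T : Theory ⌊ Σs ⌋} (w : Word ⌊ Σs ⌋ T) where
    FOAccepts⇒SOAccepts : FOAccepts A₁ w → SOAccepts A w
    FOAccepts⇒SOAccepts (r , final) = run , flatten-sound (∣-isReduct embᴿ) φF freshFᴿ final
      where
        run : Run w ⌊ Γ ⌋ (_⊨SO φ₀) (_⊨SO φT)
        run = record
          { state = λ i → state r i ∣ embᴿ
          ; srig  = λ i j → agreeRigid-∣ embᴿ (srig r i j)
          ; start = flatten-sound (∣-isReduct embᴿ) φ₀ fresh₀ᴿ (start r)
          ; step  = λ i →
              flatten-sound (isReduct-step (∣-isReduct embᴿ) (∣-isReduct embᴿ)) φT freshTᴿ (step r i) }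

    SOAccepts⇒FOAccepts : SOAccepts A w → FOAccepts A₁ w
    SOAccepts⇒FOAccepts (r , final) = run , flatten-complete isReduct-emb φF freshFᴿ final isReduct-freshF
      where
        -- The first state is the target of no transition, so its φT-block is never read.
        witnessT : Fin (suc (len w)) → Relations (D (dom w)) (ar φT)
        witnessT zero    = λ _ _ → ⊤
        witnessT (suc i) = proj₁ (step r i)

        run : Run w ⌊ Γ₁ ⌋ (_⊨ flatten embᴿ φ₀ fresh₀ᴿ) (_⊨ flatten stepᴿ φT freshTᴿ)
        run = record
          { state = λ i → expandΓ₁ (state r i) (proj₁ (start r)) (witnessT i) (proj₁ final)
          ; srig  = λ i j → agreeRigid-expand _ _ (agreeRigid-expand _ _ (agreeRigid-expand _ _ (srig r i j)))
          ; start = flatten-complete isReduct-emb φ₀ fresh₀ᴿ (start r) isReduct-fresh₀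
          ; step  = λ i →
              flatten-complete (isReduct-step isReduct-emb isReduct-emb) φT freshTᴿ (step r i) isReduct-freshT }

  A₁-sameLanguages : SameLanguages A₁ A
  A₁-sameLanguages T w = mk⇔ (FOAccepts⇒SOAccepts w) (SOAccepts⇒FOAccepts w)

mapRun : ∀ {ℓ ℓ'} {Σs : Sig k} {T : Theory Σs} {w : Word Σs T} {Γ : Sig k}
  {init : Structure (D (dom w)) Γ → Set ℓ} {init' : Structure (D (dom w)) Γ → Set ℓ'}
  {trans : Structure (D (dom w)) (Γ ⊕ Σs ⊕ NR Γ) → Set ℓ}
  {trans' : Structure (D (dom w)) (Γ ⊕ Σs ⊕ NR Γ) → Set ℓ'} →
  (∀ {M} → init M → init' M) → (∀ {M} → trans M → trans' M) →
  Run w Γ init trans → Run w Γ init' trans'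
mapRun init⇒init' trans⇒trans' r = record
  { state = state r ; srig = srig r ; start = init⇒init' (start r) ; step = λ i → trans⇒trans' (step r i) }

toSO : Sentence S → SOSentence S
toSO φ = record { m = 0 ; ar = λ () ; body = rename inj₁ᴿ φ }

⊨SO-toSO : (M : Structure Dom S) (φ : Sentence S) → M ⊨SO toSO φ ⇔ M ⊨ φ
⊨SO-toSO M φ = mk⇔ (λ (_ , M⊨) → to (⊨-rename isReduct-inj₁ φ) M⊨)
                   (λ M⊨ → (λ ()) , from (⊨-rename isReduct-inj₁ φ) M⊨)

toSOAutomaton : {Σs : FinSig k} → FOAutomaton Σs → SOAutomaton Σs
toSOAutomaton A₁ = record { Γ = Γ ; φ₀ = toSO φ₀ ; φT = toSO φT ; φF = toSO φF }
  where open FOAutomaton A₁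

toSOAutomaton-sameLanguages : {Σs : FinSig k} (A₁ : FOAutomaton Σs) → SameLanguages A₁ (toSOAutomaton A₁)
toSOAutomaton-sameLanguages A₁ T w = mk⇔
  (λ (r , final) → mapRun (from (⊨SO-toSO _ φ₀)) (from (⊨SO-toSO _ φT)) r , from (⊨SO-toSO _ φF) final)
  (λ (r , final) → mapRun (to (⊨SO-toSO _ φ₀)) (to (⊨SO-toSO _ φT)) r , to (⊨SO-toSO _ φF) final)
  where open FOAutomaton A₁

lemma1 : {k : ℕ} (Σs : FinSig k) →
    ((A : SOAutomaton Σs) → Σ (FOAutomaton Σs) λ A₁ → SameLanguages A₁ A)
    × ((A₁ : FOAutomaton Σs) → Σ (SOAutomaton Σs) λ A → SameLanguages A₁ A)
lemma1 Σs =
  (λ A → Flattening.A₁ A , Flattening.A₁-sameLanguages A) ,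
  (λ A₁ → toSOAutomaton A₁ , toSOAutomaton-sameLanguages A₁)
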